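{- Let $E$ be a finite set, $M$ a symmetric $|E|\times|E|$ matrix over $GF(2)$ with rows and columns indexed by $E$, and $a,b\in E$ distinct. Then $D(M_{ab})=D(M)_{ab}$.
   Context: $D(M)$ is the set system on $E$ whose feasible sets are those $A\subseteq E$ for which the principal submatrix $M[A]$ (rows and columns indexed by $A$) is non-singular over $GF(2)$; $M[\emptyset]$ is considered non-singular. $M_{ab}$ is the matrix obtained from $M$ by adding the column of $b$ to the column of $a$, and then in the resulting matrix adding the row of $b$ to the row of $a$. For a set system $D=(E,\mathcal{F})$, $D_{ab}=(E,\mathcal{F}_{ab})$ with $\mathcal{F}_{ab}=\mathcal{F}\triangle\{X\cup\{a\}: X\cup\{b\}\in\mathcal{F},\ X\subseteq E\setminus\{a,b\}\}$, where $\triangle$ is symmetric difference. -}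

module Defs where

open import Data.Bool using (Bool; true; false; _∧_; _xor_; not)
open import Data.Nat using (ℕ; zero; suc)
open import Data.Fin using (Fin; zero; suc; punchIn; _≟_)
open import Data.Fin.Subset using (Subset)
open import Data.List using (List; []; _∷_; length)
open import Data.List.Properties using ()
open import Data.Vec using (Vec; []; _∷_; lookup; _[_]≔_)
open import Relation.Binary.PropositionalEquality using (_≡_)
open import Relation.Nullary.Decidable using (⌊_⌋)

-- GF(2) is modelled by Bool: addition = _xor_, multiplication = _∧_.

Mat : ℕ → Set
Mat k = Fin k → Fin k → Bool

Symmetric : ∀ {n} → Mat n → Set
Symmetric M = ∀ i j → M i j ≡ M j i

⊕-sum : ∀ k → (Fin k → Bool) → Bool
⊕-sum zero    f = false
⊕-sum (suc k) f = f zero xor ⊕-sum k (λ i → f (suc i))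

-- Determinant over GF(2) by cofactor (Laplace) expansion along the first
-- row; signs are irrelevant in characteristic 2.  det of 0×0 matrix = 1.
det : ∀ k → Mat k → Bool
det zero    A = true
det (suc k) A = ⊕-sum (suc k) (λ j → A zero j ∧ det k (λ r c → A (suc r) (punchIn j c)))

elems : ∀ {n} → Subset n → List (Fin n)
elems []           = []
elems (true  ∷ xs) = zero ∷ Data.List.map suc (elems xs)
elems (false ∷ xs) = Data.List.map suc (elems xs)

principal : ∀ {n} → Mat n → (A : Subset n) → Mat (length (elems A))
principal M A i j = M (Data.List.lookup (elems A) i) (Data.List.lookup (elems A) j)

-- A set system on E = Fin n, given by the (decidable) characteristic
-- function of its family of feasible sets.
SetSystem : ℕ → Set
SetSystem n = Subset n → Bool

D : ∀ {n} → Mat n → SetSystem n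
D M A = det (length (elems A)) (principal M A)

eqᵇ : ∀ {n} → Fin n → Fin n → Bool
eqᵇ i j = ⌊ i ≟ j ⌋

addCol : ∀ {n} → Mat n → Fin n → Fin n → Mat n
addCol M a b i j = M i j xor (eqᵇ j a ∧ M i b)

addRow : ∀ {n} → Mat n → Fin n → Fin n → Mat n
addRow M a b i j = M i j xor (eqᵇ i a ∧ M b j)

pivotMat : ∀ {n} → Mat n → Fin n → Fin n → Mat n
pivotMat M a b = addRow (addCol M a b) a b

-- D_ab: F_ab = F △ { X ∪ {a} : X ∪ {b} ∈ F, X ⊆ E \ {a,b} }.
-- Y = X ∪ {a} with X ⊆ E\{a,b} iff a ∈ Y, b ∉ Y, and then X ∪ {b} = (Y \ {a}) ∪ {b}.
pivotSys : ∀ {n} → SetSystem n → Fin n → Fin n → SetSystem n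
pivotSys F a b Y =
  F Y xor (lookup Y a ∧ not (lookup Y b) ∧ F ((Y [ a ]≔ false) [ b ]≔ true))

module Submission where

-- Both sides are compared on a fixed set Y, by cases on whether Y contains a and b.
--  * a ∉ Y: the pivot only changes row and column a, so M_ab[Y] = M[Y].
--  * a, b ∈ Y: M_ab[Y] = (M[Y])_ab arises from M[Y] by adding a column and then a
--    row to another one, which preserves the determinant.
--  * a ∈ Y, b ∉ Y: with Z = Y ∪ {b}, both Y = Z - b and (Y - a) ∪ {b} = Z - a are
--    principal minors of M[Z]; expanding det M_ab[Y] by additivity in row and
--    column a gives det M[Y] + det M[Y - a + b] plus two mixed terms that are
--    transposes of each other, hence cancel by symmetry (module PivotMinor).

open import Defs
open import Algebra.Bundles using (CommutativeRing; CommutativeMonoid)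
import Algebra.Properties.CommutativeSemigroup as CommSemigroupProperties
open import Data.Bool using (Bool; true; false; _∧_; _xor_; if_then_else_)
open import Data.Bool.Properties
  using (xor-assoc; xor-same; xor-identityʳ; ∧-zeroʳ; ∧-distribˡ-xor; ∧-distribʳ-xor;
         xor-∧-commutativeRing; ∧-commutativeMonoid)
open import Data.Empty using (⊥-elim)
open import Data.Fin using (Fin; zero; suc; punchIn; punchOut; cast; _≟_)
open import Data.Fin.Properties
  using (punchIn-injective; punchInᵢ≢i; punchIn-punchOut; cast-is-id; cast-trans; suc-injective)
open import Data.Fin.Subset using (Subset)
open import Data.List using (List; []; _∷_; length; map)
import Data.List as List
open import Data.List.Properties using (length-map)
open import Data.Nat using (ℕ; zero; suc)
open import Data.Product using (Σ; _×_; _,_)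
open import Data.Vec using ([]; _∷_; lookup; _[_]≔_)
open import Data.Vec.Properties
  using (lookup∘update; lookup∘update′; []≔-idempotent; []≔-commutes; []≔-lookup)
open import Data.Vec.Functional using (insertAt; removeAt)
open import Data.Vec.Functional.Properties using (insertAt-lookup; insertAt-punchIn)
open import Function.Definitions using (Injective)
open import Relation.Binary.PropositionalEquality
open import Relation.Nullary using (yes; no)
open import Relation.Nullary.Decidable using (isYes≗does; dec-true; dec-false)

open CommSemigroupProperties (CommutativeRing.+-commutativeSemigroup xor-∧-commutativeRing)
  using () renaming (interchange to xor-interchange; x∙yz≈y∙xz to xor-leftComm)
open CommSemigroupProperties (CommutativeMonoid.commutativeSemigroup ∧-commutativeMonoid)
  using () renaming (x∙yz≈y∙xz to ∧-leftComm)

xor-equal : ∀ {x y} → x ≡ y → x xor y ≡ false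
xor-equal {x} refl = xor-same x

xor-cancelMiddle : ∀ x z y → (x xor z) xor (z xor y) ≡ x xor y
xor-cancelMiddle x z y = begin
  (x xor z) xor (z xor y)  ≡⟨ xor-assoc x z (z xor y) ⟩
  x xor (z xor (z xor y))  ≡⟨ cong (x xor_) (sym (xor-assoc z z y)) ⟩
  x xor ((z xor z) xor y)  ≡⟨ cong (λ w → x xor (w xor y)) (xor-same z) ⟩
  x xor y                  ∎
  where open ≡-Reasoning

eqᵇ-true : ∀ {n} {i j : Fin n} → i ≡ j → eqᵇ i j ≡ true
eqᵇ-true {i = i} {j} i≡j = trans (isYes≗does (i ≟ j)) (dec-true (i ≟ j) i≡j)

eqᵇ-false : ∀ {n} {i j : Fin n} → i ≢ j → eqᵇ i j ≡ false
eqᵇ-false {i = i} {j} i≢j = trans (isYes≗does (i ≟ j)) (dec-false (i ≟ j) i≢j)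

eqᵇ-injective : ∀ {m n} (h : Fin m → Fin n) → Injective _≡_ _≡_ h →
  ∀ x y → eqᵇ (h x) (h y) ≡ eqᵇ x y
eqᵇ-injective h h-inj x y with x ≟ y
... | yes x≡y = eqᵇ-true (cong h x≡y)
... | no  x≢y = eqᵇ-false (λ hx≡hy → x≢y (h-inj hx≡hy))

⊕-cong : ∀ k {f g : Fin k → Bool} → (∀ i → f i ≡ g i) → ⊕-sum k f ≡ ⊕-sum k g
⊕-cong zero    f≗g = refl
⊕-cong (suc k) f≗g = cong₂ _xor_ (f≗g zero) (⊕-cong k (λ i → f≗g (suc i)))

⊕-distrib-xor : ∀ k (f g : Fin k → Bool) →
  ⊕-sum k (λ i → f i xor g i) ≡ ⊕-sum k f xor ⊕-sum k g
⊕-distrib-xor zero    f g = refl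
⊕-distrib-xor (suc k) f g =
  trans (cong ((f zero xor g zero) xor_) (⊕-distrib-xor k (λ i → f (suc i)) (λ i → g (suc i))))
        (xor-interchange (f zero) (g zero) _ _)

⊕-zero : ∀ k (f : Fin k → Bool) → (∀ i → f i ≡ false) → ⊕-sum k f ≡ false
⊕-zero zero    f f≗0 = refl
⊕-zero (suc k) f f≗0 = cong₂ _xor_ (f≗0 zero) (⊕-zero k (λ i → f (suc i)) (λ i → f≗0 (suc i)))

∧-distrib-⊕ : ∀ k x (f : Fin k → Bool) → x ∧ ⊕-sum k f ≡ ⊕-sum k (λ i → x ∧ f i)
∧-distrib-⊕ zero    x f = ∧-zeroʳ x
∧-distrib-⊕ (suc k) x f =
  trans (∧-distribˡ-xor x (f zero) _) (cong ((x ∧ f zero) xor_) (∧-distrib-⊕ k x (λ i → f (suc i))))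

⊕-comm : ∀ k m (f : Fin k → Fin m → Bool) →
  ⊕-sum k (λ i → ⊕-sum m (f i)) ≡ ⊕-sum m (λ j → ⊕-sum k (λ i → f i j))
⊕-comm zero    m f = sym (⊕-zero m (λ _ → false) (λ _ → refl))
⊕-comm (suc k) m f =
  trans (cong (⊕-sum m (f zero) xor_) (⊕-comm k m (λ i → f (suc i))))
        (sym (⊕-distrib-xor m (f zero) _))

⊕-extract : ∀ k (f : Fin (suc k) → Bool) p →
  ⊕-sum (suc k) f ≡ f p xor ⊕-sum k (λ i → f (punchIn p i))
⊕-extract k       f zero    = refl
⊕-extract (suc k) f (suc p) =
  trans (cong (f zero xor_) (⊕-extract k (λ i → f (suc i)) p))
        (xor-leftComm (f zero) (f (suc p)) _)

det-cong : ∀ k {A B : Mat k} → (∀ i j → A i j ≡ B i j) → det k A ≡ det k B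
det-cong zero    A≗B = refl
det-cong (suc k) A≗B =
  ⊕-cong (suc k) (λ j → cong₂ _∧_ (A≗B zero j) (det-cong k (λ r c → A≗B (suc r) (punchIn j c))))

minor : ∀ {k} → Fin (suc k) → Mat (suc k) → Mat k
minor j A r c = A (suc r) (punchIn j c)

_ᵀ : ∀ {k} → Mat k → Mat k
(A ᵀ) r c = A c r

det-columnExpansion : ∀ k (A : Mat (suc k)) →
  det (suc k) A ≡ ⊕-sum (suc k) (λ i → A i zero ∧ det k (λ r c → A (punchIn i r) (suc c)))
det-columnExpansion zero    A = refl
det-columnExpansion (suc k) A = cong ((A zero zero ∧ det (suc k) (minor zero A)) xor_) (begin
    ⊕-sum (suc k) (λ j → A zero (suc j) ∧ det (suc k) (minor (suc j) A))
  ≡⟨ ⊕-cong (suc k) (λ j → cong (A zero (suc j) ∧_) (det-columnExpansion k (minor (suc j) A))) ⟩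
    ⊕-sum (suc k) (λ j → A zero (suc j) ∧ ⊕-sum (suc k) (λ i → A (suc i) zero ∧ X i j))
  ≡⟨ ⊕-cong (suc k) (λ j → ∧-distrib-⊕ (suc k) (A zero (suc j)) (λ i → A (suc i) zero ∧ X i j)) ⟩
    ⊕-sum (suc k) (λ j → ⊕-sum (suc k) (λ i → A zero (suc j) ∧ (A (suc i) zero ∧ X i j)))
  ≡⟨ ⊕-comm (suc k) (suc k) (λ j i → A zero (suc j) ∧ (A (suc i) zero ∧ X i j)) ⟩
    ⊕-sum (suc k) (λ i → ⊕-sum (suc k) (λ j → A zero (suc j) ∧ (A (suc i) zero ∧ X i j)))
  ≡⟨ ⊕-cong (suc k) (λ i → trans (⊕-cong (suc k) (λ j → ∧-leftComm (A zero (suc j)) (A (suc i) zero) (X i j)))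
                                  (sym (∧-distrib-⊕ (suc k) (A (suc i) zero) (λ j → A zero (suc j) ∧ X i j)))) ⟩
    ⊕-sum (suc k) (λ i → A (suc i) zero ∧ ⊕-sum (suc k) (λ j → A zero (suc j) ∧ X i j))
  ∎)
  where
  open ≡-Reasoning
  X : Fin (suc k) → Fin (suc k) → Bool
  X i j = det k (λ r c → A (suc (punchIn i r)) (suc (punchIn j c)))

det-transpose : ∀ k (A : Mat k) → det k (A ᵀ) ≡ det k A
det-transpose zero    A = refl
det-transpose (suc k) A =
  trans (⊕-cong (suc k) (λ j → cong (A j zero ∧_) (det-transpose k (λ r c → A (punchIn j r) (suc c)))))
        (sym (det-columnExpansion k A))

det-additiveCol : ∀ k (A B C : Mat k) (c : Fin k) →
  (∀ r j → j ≢ c → A r j ≡ C r j) → (∀ r j → j ≢ c → B r j ≡ C r j) →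
  (∀ r → C r c ≡ A r c xor B r c) → det k C ≡ det k A xor det k B
det-additiveCol (suc k) A B C c A≈C B≈C C-sum =
  trans (⊕-cong (suc k) term)
        (⊕-distrib-xor (suc k) (λ j → A zero j ∧ det k (minor j A)) (λ j → B zero j ∧ det k (minor j B)))
  where
  term : ∀ j → C zero j ∧ det k (minor j C)
             ≡ (A zero j ∧ det k (minor j A)) xor (B zero j ∧ det k (minor j B))
  -- the term of column c: its minor avoids column c, so A, B and C share it
  term j with j ≟ c
  ... | yes refl = begin
      C zero j ∧ det k (minor j C)
    ≡⟨ cong (_∧ det k (minor j C)) (C-sum zero) ⟩
      (A zero j xor B zero j) ∧ det k (minor j C)
    ≡⟨ ∧-distribʳ-xor (det k (minor j C)) (A zero j) (B zero j) ⟩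
      (A zero j ∧ det k (minor j C)) xor (B zero j ∧ det k (minor j C))
    ≡⟨ cong₂ _xor_ (cong (A zero j ∧_) (sharedMinor A A≈C)) (cong (B zero j ∧_) (sharedMinor B B≈C)) ⟩
      (A zero j ∧ det k (minor j A)) xor (B zero j ∧ det k (minor j B))
    ∎
    where
    open ≡-Reasoning
    sharedMinor : ∀ X → (∀ r j′ → j′ ≢ j → X r j′ ≡ C r j′) → det k (minor j C) ≡ det k (minor j X)
    sharedMinor X X≈C = det-cong k (λ r c′ → sym (X≈C (suc r) (punchIn j c′) (punchInᵢ≢i j c′)))
  -- any other term: the first-row entries agree and the minors are related as A, B, C
  ... | no j≢c = begin
      C zero j ∧ det k (minor j C)
    ≡⟨ cong₂ _∧_ (sym (A≈C zero j j≢c)) minorSum ⟩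
      A zero j ∧ (det k (minor j A) xor det k (minor j B))
    ≡⟨ ∧-distribˡ-xor (A zero j) (det k (minor j A)) (det k (minor j B)) ⟩
      (A zero j ∧ det k (minor j A)) xor (A zero j ∧ det k (minor j B))
    ≡⟨ cong (λ x → (A zero j ∧ det k (minor j A)) xor (x ∧ det k (minor j B)))
            (trans (A≈C zero j j≢c) (sym (B≈C zero j j≢c))) ⟩
      (A zero j ∧ det k (minor j A)) xor (B zero j ∧ det k (minor j B))
    ∎
    where
    open ≡-Reasoning
    c′ : Fin k
    c′ = punchOut j≢c
    c≡ : punchIn j c′ ≡ c
    c≡ = punchIn-punchOut j≢c
    offColumn : ∀ X → (∀ r j′ → j′ ≢ c → X r j′ ≡ C r j′) →
      ∀ r j′ → j′ ≢ c′ → minor j X r j′ ≡ minor j C r j′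
    offColumn X X≈C r j′ j′≢c′ =
      X≈C (suc r) (punchIn j j′) (λ eq → j′≢c′ (punchIn-injective j j′ c′ (trans eq (sym c≡))))
    minorSum : det k (minor j C) ≡ det k (minor j A) xor det k (minor j B)
    minorSum = det-additiveCol k (minor j A) (minor j B) (minor j C) c′
      (offColumn A A≈C) (offColumn B B≈C)
      (λ r → trans (cong (C (suc r)) c≡)
                   (trans (C-sum (suc r)) (sym (cong₂ _xor_ (cong (A (suc r)) c≡) (cong (B (suc r)) c≡)))))

det-additiveRow : ∀ k (A B C : Mat k) (r₀ : Fin k) →
  (∀ r j → r ≢ r₀ → A r j ≡ C r j) → (∀ r j → r ≢ r₀ → B r j ≡ C r j) →
  (∀ j → C r₀ j ≡ A r₀ j xor B r₀ j) → det k C ≡ det k A xor det k B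
det-additiveRow k A B C r₀ A≈C B≈C C-sum = begin
    det k C
  ≡⟨ sym (det-transpose k C) ⟩
    det k (C ᵀ)
  ≡⟨ det-additiveCol k (A ᵀ) (B ᵀ) (C ᵀ) r₀ (λ r j r≢r₀ → A≈C j r r≢r₀) (λ r j r≢r₀ → B≈C j r r≢r₀) C-sum ⟩
    det k (A ᵀ) xor det k (B ᵀ)
  ≡⟨ cong₂ _xor_ (det-transpose k A) (det-transpose k B) ⟩
    det k A xor det k B
  ∎
  where open ≡-Reasoning

punchIn-exchange : ∀ {m} (q : Fin (suc (suc m))) (p′ : Fin (suc m)) →
  Σ (Fin (suc m)) λ q″ → (punchIn (punchIn q p′) q″ ≡ q) ×
    (∀ c → punchIn q (punchIn p′ c) ≡ punchIn (punchIn q p′) (punchIn q″ c))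
punchIn-exchange zero      p′   = zero , refl , λ c → refl
punchIn-exchange (suc q)   zero = q , refl , λ c → refl
punchIn-exchange {suc m} (suc q) (suc p′) with punchIn-exchange q p′
... | q″ , q≡ , commute = suc q″ , cong suc q≡ , λ { zero → refl ; (suc c) → cong suc (commute c) }

toFront : ∀ {k} → Fin (suc k) → Fin (suc k) → Fin (suc k)
toFront p zero    = p
toFront p (suc c) = punchIn p c

-- Moving a column to the front does not change the determinant over GF(2)
-- (the sign of the permutation is invisible in characteristic 2).
det-toFront : ∀ k (B : Mat (suc k)) p → det (suc k) (λ r c → B r (toFront p c)) ≡ det (suc k) B
det-toFront zero    B zero = refl
det-toFront (suc k) B p =
  trans (cong ((B zero p ∧ det (suc k) (minor p B)) xor_) (⊕-cong (suc k) term))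
        (sym (⊕-extract (suc k) (λ j → B zero j ∧ det (suc k) (minor j B)) p))
  where
  -- the minor of column j of the reindexed matrix is the minor of column punchIn p j
  -- of B, itself reindexed by toFront
  term : ∀ j → B zero (punchIn p j) ∧ det (suc k) (λ r c → B (suc r) (toFront p (punchIn (suc j) c)))
             ≡ B zero (punchIn p j) ∧ det (suc k) (minor (punchIn p j) B)
  term j with punchIn-exchange p j
  ... | q″ , q≡ , commute = cong (B zero (punchIn p j) ∧_)
    (trans (det-cong (suc k) reindex) (det-toFront k (minor (punchIn p j) B) q″))
    where
    reindex : ∀ r c → B (suc r) (toFront p (punchIn (suc j) c)) ≡ minor (punchIn p j) B r (toFront q″ c)
    reindex r zero    = cong (B (suc r)) (sym q≡)
    reindex r (suc c) = cong (B (suc r)) (commute c)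

det-toFront-both : ∀ k (Z : Mat (suc k)) s →
  det (suc k) (λ r c → Z (toFront s r) (toFront s c)) ≡ det (suc k) Z
det-toFront-both k Z s = begin
    det (suc k) (λ r c → Z (toFront s r) (toFront s c))
  ≡⟨ det-toFront k (λ r c → Z (toFront s r) c) s ⟩
    det (suc k) (λ r c → Z (toFront s r) c)
  ≡⟨ sym (det-transpose (suc k) (λ r c → Z (toFront s r) c)) ⟩
    det (suc k) (λ r c → Z (toFront s c) r)
  ≡⟨ det-toFront k (Z ᵀ) s ⟩
    det (suc k) (Z ᵀ)
  ≡⟨ det-transpose (suc k) Z ⟩
    det (suc k) Z
  ∎
  where open ≡-Reasoning

det-equalFirstColumn : ∀ k (B : Mat (suc k)) i → (∀ r → B r zero ≡ B r (suc i)) → det (suc k) B ≡ false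
det-equalFirstColumn (suc k) B i col≡ = begin
    T zero xor ⊕-sum (suc k) (λ j → T (suc j))
  ≡⟨ cong (T zero xor_) (⊕-extract k (λ j → T (suc j)) i) ⟩
    T zero xor (T (suc i) xor ⊕-sum k (λ j → T (suc (punchIn i j))))
  ≡⟨ cong (λ x → T zero xor (T (suc i) xor x)) (⊕-zero k _ otherTerms) ⟩
    T zero xor (T (suc i) xor false)
  ≡⟨ xor-equal (trans (cong₂ _∧_ (col≡ zero) sameMinor) (sym (xor-identityʳ (T (suc i))))) ⟩
    false
  ∎
  where
  open ≡-Reasoning
  T : Fin (suc (suc k)) → Bool
  T j = B zero j ∧ det (suc k) (minor j B)
  -- the minors of columns 0 and i+1 differ by moving column i to the front
  sameMinor : det (suc k) (minor zero B) ≡ det (suc k) (minor (suc i) B)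
  sameMinor = sym (trans (det-cong (suc k) reindex) (det-toFront k (minor zero B) i))
    where
    reindex : ∀ r c → minor (suc i) B r c ≡ minor zero B r (toFront i c)
    reindex r zero    = col≡ (suc r)
    reindex r (suc c) = refl
  -- every other minor still contains both equal columns
  otherTerms : ∀ j → T (suc (punchIn i j)) ≡ false
  otherTerms j = trans (cong (B zero (suc J′) ∧_)
      (det-equalFirstColumn k (minor (suc J′) B) (punchOut J≢i)
        (λ r → trans (col≡ (suc r)) (cong (λ z → B (suc r) (suc z)) (sym (punchIn-punchOut J≢i))))))
    (∧-zeroʳ (B zero (suc J′)))
    where
    J′ : Fin (suc k)
    J′ = punchIn i j
    J≢i : J′ ≢ i
    J≢i = punchInᵢ≢i i j

det-equalColumns : ∀ k (B : Mat k) i j → i ≢ j → (∀ r → B r i ≡ B r j) → det k B ≡ false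
det-equalColumns (suc k) B i j i≢j col≡ =
  trans (sym (det-toFront k B j))
        (det-equalFirstColumn k (λ r c → B r (toFront j c)) (punchOut j≢i)
          (λ r → trans (sym (col≡ r)) (cong (B r) (sym (punchIn-punchOut j≢i)))))
  where
  j≢i : j ≢ i
  j≢i j≡i = i≢j (sym j≡i)

det-addCol : ∀ k (N : Mat k) i j → i ≢ j → det k (addCol N i j) ≡ det k N
det-addCol k N i j i≢j = begin
    det k (addCol N i j)
  ≡⟨ det-additiveCol k N Nⱼ (addCol N i j) i offCol offColⱼ onCol ⟩
    det k N xor det k Nⱼ
  ≡⟨ cong (det k N xor_) (det-equalColumns k Nⱼ i j i≢j twoCols) ⟩
    det k N xor false
  ≡⟨ xor-identityʳ (det k N) ⟩
    det k N
  ∎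
  where
  open ≡-Reasoning
  Nⱼ : Mat k
  Nⱼ r c = if eqᵇ c i then N r j else N r c
  offCol : ∀ r c → c ≢ i → N r c ≡ addCol N i j r c
  offCol r c c≢i rewrite eqᵇ-false c≢i = sym (xor-identityʳ (N r c))
  offColⱼ : ∀ r c → c ≢ i → Nⱼ r c ≡ addCol N i j r c
  offColⱼ r c c≢i rewrite eqᵇ-false c≢i = sym (xor-identityʳ (N r c))
  onCol : ∀ r → addCol N i j r i ≡ N r i xor Nⱼ r i
  onCol r rewrite eqᵇ-true (refl {x = i}) = refl
  twoCols : ∀ r → Nⱼ r i ≡ Nⱼ r j
  twoCols r rewrite eqᵇ-true (refl {x = i}) | eqᵇ-false (λ (j≡i : j ≡ i) → i≢j (sym j≡i)) = refl

det-pivotMat : ∀ k (N : Mat k) i j → i ≢ j → det k (pivotMat N i j) ≡ det k N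
det-pivotMat k N i j i≢j = begin
    det k (pivotMat N i j)
  ≡⟨ sym (det-transpose k (pivotMat N i j)) ⟩
    det k (addCol (addCol N i j ᵀ) i j)
  ≡⟨ det-addCol k (addCol N i j ᵀ) i j i≢j ⟩
    det k (addCol N i j ᵀ)
  ≡⟨ det-transpose k (addCol N i j) ⟩
    det k (addCol N i j)
  ≡⟨ det-addCol k N i j i≢j ⟩
    det k N
  ∎
  where open ≡-Reasoning

restrict : ∀ {n k} → Mat n → (Fin k → Fin n) → Mat k
restrict M h r c = M (h r) (h c)

-- In a matrix N indexed by Fin (2+k), let b sit at
-- position q and a at position p = punchIn q a′.  Deleting b, the pivoted matrix
-- N_ab differs from N only in row and column a′, where b's row and column are added.
-- Expanding by additivity in that row and that column produces four determinants:
-- N without b, two mixed terms that are transposes of each other when N is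
-- symmetric (so they cancel), and N with b moved into a's slot, which is N without
-- a up to a simultaneous reordering of rows and columns.
module PivotMinor {k} (N : Mat (suc (suc k))) (q : Fin (suc (suc k))) (a′ : Fin (suc k)) where

  p : Fin (suc (suc k))
  p = punchIn q a′

  withoutB withoutA pivoted colAdded rowAdded colB rowB bInSlotA : Mat (suc k)
  withoutB = restrict N (punchIn q)
  withoutA = restrict N (punchIn p)
  pivoted  = restrict (pivotMat N p q) (punchIn q)
  colAdded r c = addCol N p q (punchIn q r) (punchIn q c)
  rowAdded r c = if eqᵇ r a′ then addCol N p q q (punchIn q c) else colAdded r c
  colB r c = if eqᵇ c a′ then N (punchIn q r) q else withoutB r c
  rowB r c = if eqᵇ r a′ then N q (punchIn q c) else withoutB r c
  bInSlotA r c = N (slot r) (slot c)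
    where
    slot : Fin (suc k) → Fin (suc (suc k))
    slot x = if eqᵇ x a′ then q else punchIn q x

  atA : ∀ c → eqᵇ (punchIn q c) p ≡ eqᵇ c a′
  atA c = eqᵇ-injective (punchIn q) (punchIn-injective q _ _) c a′

  pivoted-splitRow : det (suc k) pivoted ≡ det (suc k) colAdded xor det (suc k) rowAdded
  pivoted-splitRow = det-additiveRow (suc k) colAdded rowAdded pivoted a′ off₁ off₂ on
    where
    off₁ : ∀ r c → r ≢ a′ → colAdded r c ≡ pivoted r c
    off₁ r c r≢a′ rewrite atA r | eqᵇ-false r≢a′ = sym (xor-identityʳ _)
    off₂ : ∀ r c → r ≢ a′ → rowAdded r c ≡ pivoted r c
    off₂ r c r≢a′ rewrite atA r | eqᵇ-false r≢a′ = sym (xor-identityʳ _)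
    on : ∀ c → pivoted a′ c ≡ colAdded a′ c xor rowAdded a′ c
    on c rewrite eqᵇ-true (refl {x = p}) | eqᵇ-true (refl {x = a′}) = refl

  colAdded-splitCol : det (suc k) colAdded ≡ det (suc k) withoutB xor det (suc k) colB
  colAdded-splitCol = det-additiveCol (suc k) withoutB colB colAdded a′ off₁ off₂ on
    where
    off₁ : ∀ r c → c ≢ a′ → withoutB r c ≡ colAdded r c
    off₁ r c c≢a′ rewrite atA c | eqᵇ-false c≢a′ = sym (xor-identityʳ _)
    off₂ : ∀ r c → c ≢ a′ → colB r c ≡ colAdded r c
    off₂ r c c≢a′ rewrite atA c | eqᵇ-false c≢a′ = sym (xor-identityʳ _)
    on : ∀ r → colAdded r a′ ≡ withoutB r a′ xor colB r a′
    on r rewrite eqᵇ-true (refl {x = p}) | eqᵇ-true (refl {x = a′}) = refl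

  rowAdded-splitCol : det (suc k) rowAdded ≡ det (suc k) rowB xor det (suc k) bInSlotA
  rowAdded-splitCol = det-additiveCol (suc k) rowB bInSlotA rowAdded a′ off₁ off₂ on
    where
    off₁ : ∀ r c → c ≢ a′ → rowB r c ≡ rowAdded r c
    off₁ r c c≢a′ rewrite atA c | eqᵇ-false c≢a′ with eqᵇ r a′
    ... | true  = sym (xor-identityʳ _)
    ... | false = sym (xor-identityʳ _)
    off₂ : ∀ r c → c ≢ a′ → bInSlotA r c ≡ rowAdded r c
    off₂ r c c≢a′ rewrite atA c | eqᵇ-false c≢a′ with eqᵇ r a′
    ... | true  = sym (xor-identityʳ _)
    ... | false = sym (xor-identityʳ _)
    on : ∀ r → rowAdded r a′ ≡ rowB r a′ xor bInSlotA r a′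
    on r rewrite eqᵇ-true (refl {x = p}) | eqᵇ-true (refl {x = a′}) with eqᵇ r a′
    ... | true  = refl
    ... | false = refl

  -- For symmetric N the two mixed terms are transposes of each other.
  rowB-colB : Symmetric N → det (suc k) rowB ≡ det (suc k) colB
  rowB-colB N-sym = trans (det-cong (suc k) transposed) (det-transpose (suc k) colB)
    where
    transposed : ∀ r c → rowB r c ≡ colB c r
    transposed r c with eqᵇ r a′
    ... | true  = N-sym q (punchIn q c)
    ... | false = N-sym (punchIn q r) (punchIn q c)

  bInSlotA-withoutA : det (suc k) bInSlotA ≡ det (suc k) withoutA
  bInSlotA-withoutA with punchIn-exchange q a′
  ... | q″ , q≡ , commute = begin
      det (suc k) bInSlotA
    ≡⟨ sym (det-toFront-both k bInSlotA a′) ⟩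
      det (suc k) (λ r c → bInSlotA (toFront a′ r) (toFront a′ c))
    ≡⟨ det-cong (suc k) (λ r c → cong₂ N (reorder r) (reorder c)) ⟩
      det (suc k) (λ r c → withoutA (toFront q″ r) (toFront q″ c))
    ≡⟨ det-toFront-both k withoutA q″ ⟩
      det (suc k) withoutA
    ∎
    where
    open ≡-Reasoning
    -- after moving a′ (holding b) to the front, the index sets agree
    reorder : ∀ x → (if eqᵇ (toFront a′ x) a′ then q else punchIn q (toFront a′ x))
                    ≡ punchIn p (toFront q″ x)
    reorder zero    rewrite eqᵇ-true (refl {x = a′}) = sym q≡
    reorder (suc c) rewrite eqᵇ-false (punchInᵢ≢i a′ c) = commute c

  det-pivoted : Symmetric N → det (suc k) pivoted ≡ det (suc k) withoutB xor det (suc k) withoutA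
  det-pivoted N-sym = begin
      det (suc k) pivoted
    ≡⟨ pivoted-splitRow ⟩
      det (suc k) colAdded xor det (suc k) rowAdded
    ≡⟨ cong₂ _xor_ colAdded-splitCol rowAdded-splitCol ⟩
      (det (suc k) withoutB xor det (suc k) colB) xor (det (suc k) rowB xor det (suc k) bInSlotA)
    ≡⟨ cong₂ (λ x y → (det (suc k) withoutB xor det (suc k) colB) xor (x xor y))
             (rowB-colB N-sym) bInSlotA-withoutA ⟩
      (det (suc k) withoutB xor det (suc k) colB) xor (det (suc k) colB xor det (suc k) withoutA)
    ≡⟨ xor-cancelMiddle (det (suc k) withoutB) (det (suc k) colB) (det (suc k) withoutA) ⟩
      det (suc k) withoutB xor det (suc k) withoutA
    ∎
    where open ≡-Reasoning

det-pivotMinor : ∀ {k} (N : Mat (suc (suc k))) → Symmetric N → ∀ p q → p ≢ q →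
  det (suc k) (restrict (pivotMat N p q) (punchIn q))
    ≡ det (suc k) (restrict N (punchIn q)) xor det (suc k) (restrict N (punchIn p))
det-pivotMinor {k} N N-sym p q p≢q =
  subst Identity (punchIn-punchOut q≢p) (PivotMinor.det-pivoted N q (punchOut q≢p) N-sym)
  where
  q≢p : q ≢ p
  q≢p q≡p = p≢q (sym q≡p)
  Identity : Fin (suc (suc k)) → Set
  Identity p₀ = det (suc k) (restrict (pivotMat N p₀ q) (punchIn q))
              ≡ det (suc k) (restrict N (punchIn q)) xor det (suc k) (restrict N (punchIn p₀))

pivotMat-restrict : ∀ {n k} (M : Mat n) (h : Fin k → Fin n) → Injective _≡_ _≡_ h →
  ∀ {a b} p q → h p ≡ a → h q ≡ b →
  ∀ r c → pivotMat M a b (h r) (h c) ≡ pivotMat (restrict M h) p q r c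
pivotMat-restrict M h h-inj p q refl refl r c
  rewrite eqᵇ-injective h h-inj r p | eqᵇ-injective h h-inj c p = refl

deleteDet : ∀ {n m} → Mat n → (Fin m → Fin n) → Fin m → Bool
deleteDet {m = suc k} M h p = det k (restrict M (removeAt h p))

deleteDet-pivot : ∀ {n m} (M : Mat n) → Symmetric M → (h : Fin m → Fin n) → Injective _≡_ _≡_ h →
  ∀ p q → p ≢ q → deleteDet (pivotMat M (h p) (h q)) h q ≡ deleteDet M h q xor deleteDet M h p
deleteDet-pivot {m = suc zero} M M-sym h h-inj zero zero p≢q = ⊥-elim (p≢q refl)
deleteDet-pivot {m = suc (suc k)} M M-sym h h-inj p q p≢q =
  trans (det-cong (suc k) (λ r c → pivotMat-restrict M h h-inj p q refl refl (punchIn q r) (punchIn q c)))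
        (det-pivotMinor (restrict M h) (λ r c → M-sym (h r) (h c)) p q p≢q)

size : ∀ {n} → Subset n → ℕ
size []          = zero
size (true  ∷ Y) = suc (size Y)
size (false ∷ Y) = size Y

enum : ∀ {n} (Y : Subset n) → Fin (size Y) → Fin n
enum (true  ∷ Y) zero    = zero
enum (true  ∷ Y) (suc i) = suc (enum Y i)
enum (false ∷ Y) i       = suc (enum Y i)

enum-injective : ∀ {n} (Y : Subset n) → Injective _≡_ _≡_ (enum Y)
enum-injective (true  ∷ Y) {zero}  {zero}  _  = refl
enum-injective (true  ∷ Y) {suc i} {suc j} eq = cong suc (enum-injective Y (suc-injective eq))
enum-injective (false ∷ Y) {i}     {j}     eq = enum-injective Y (suc-injective eq)

enum-∈ : ∀ {n} (Y : Subset n) i → lookup Y (enum Y i) ≡ true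
enum-∈ (true  ∷ Y) zero    = refl
enum-∈ (true  ∷ Y) (suc i) = enum-∈ Y i
enum-∈ (false ∷ Y) i       = enum-∈ Y i

enum-surjective : ∀ {n} (Y : Subset n) x → lookup Y x ≡ true → Σ (Fin (size Y)) λ p → enum Y p ≡ x
enum-surjective (true  ∷ Y) zero    x∈Y = zero , refl
enum-surjective (true  ∷ Y) (suc x) x∈Y with enum-surjective Y x x∈Y
... | p , enum≡ = suc p , cong suc enum≡
enum-surjective (false ∷ Y) (suc x) x∈Y with enum-surjective Y x x∈Y
... | p , enum≡ = p , cong suc enum≡

map-insertAt : ∀ {k} {A B : Set} (g : A → B) (f : Fin k → A) p x i →
  insertAt (λ j → g (f j)) p (g x) i ≡ g (insertAt f p x i)
map-insertAt         g f zero    x zero    = refl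
map-insertAt         g f zero    x (suc i) = refl
map-insertAt {suc k} g f (suc p) x zero    = refl
map-insertAt {suc k} g f (suc p) x (suc i) = map-insertAt g (λ j → f (suc j)) p x i

enum-delete : ∀ {n} (Y : Subset n) x → lookup Y x ≡ true →
  Σ (size Y ≡ suc (size (Y [ x ]≔ false))) λ e → Σ (Fin (suc (size (Y [ x ]≔ false)))) λ p →
    ∀ i → enum Y i ≡ insertAt (enum (Y [ x ]≔ false)) p x (cast e i)
enum-delete (true ∷ Y) zero x∈Y = refl , zero , λ
  { zero    → refl
  ; (suc i) → cong (λ j → suc (enum Y j)) (sym (cast-is-id refl i)) }
enum-delete (true ∷ Y) (suc x) x∈Y with enum-delete Y x x∈Y
... | e , p , enum≡ = cong suc e , suc p , λ
  { zero    → refl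
  ; (suc i) → trans (cong suc (enum≡ i)) (sym (map-insertAt suc (enum (Y [ x ]≔ false)) p x (cast e i))) }
enum-delete (false ∷ Y) (suc x) x∈Y with enum-delete Y x x∈Y
... | e , p , enum≡ = e , p , λ i →
  trans (cong suc (enum≡ i)) (sym (map-insertAt suc (enum (Y [ x ]≔ false)) p x (cast e i)))

deleteDet-insertAt : ∀ {n m k} (e : m ≡ suc k) (h : Fin m → Fin n) (f : Fin k → Fin n) p x →
  (∀ i → h i ≡ insertAt f p x (cast e i)) →
  Σ (Fin m) λ p′ → (h p′ ≡ x) × (∀ M → det k (restrict M f) ≡ deleteDet M h p′)
deleteDet-insertAt refl h f p x h≡ =
  p , trans (h≡′ p) (insertAt-lookup f p x) ,
  λ M → det-cong _ (λ r c → sym (cong₂ M (trans (h≡′ _) (insertAt-punchIn f p x r))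
                                  (trans (h≡′ _) (insertAt-punchIn f p x c))))
  where
  h≡′ : ∀ i → h i ≡ insertAt f p x i
  h≡′ i = trans (h≡ i) (cong (insertAt f p x) (cast-is-id refl i))

lookup-map : ∀ {A B : Set} (f : A → B) (l : List A) i →
  List.lookup (map f l) i ≡ f (List.lookup l (cast (length-map f l) i))
lookup-map f (x ∷ l) zero    = refl
lookup-map f (x ∷ l) (suc i) = lookup-map f l i

elems-enum : ∀ {n} (Y : Subset n) →
  Σ (length (elems Y) ≡ size Y) λ e → ∀ i → List.lookup (elems Y) i ≡ enum Y (cast e i)
elems-enum []          = refl , λ ()
elems-enum (true  ∷ Y) with elems-enum Y
... | e , elems≡ = cong suc (trans (length-map suc (elems Y)) e) , λ
  { zero    → refl
  ; (suc i) → trans (lookup-map suc (elems Y) i)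
                    (cong suc (trans (elems≡ _) (cong (enum Y) (cast-trans (length-map suc (elems Y)) e i)))) }
elems-enum (false ∷ Y) with elems-enum Y
... | e , elems≡ = trans (length-map suc (elems Y)) e , λ i →
  trans (lookup-map suc (elems Y) i)
        (cong suc (trans (elems≡ _) (cong (enum Y) (cast-trans (length-map suc (elems Y)) e i))))

D-enum : ∀ {n} (M : Mat n) Y → D M Y ≡ det (size Y) (restrict M (enum Y))
D-enum M Y with elems-enum Y
... | e , elems≡ = reindex e elems≡
  where
  reindex : ∀ {k} (e : length (elems Y) ≡ k) {f : Fin k → Fin _} →
    (∀ i → List.lookup (elems Y) i ≡ f (cast e i)) → D M Y ≡ det k (restrict M f)
  reindex refl {f} lookup≡ = det-cong _ (λ r c → cong₂ M (same r) (same c))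
    where
    same : ∀ i → List.lookup (elems Y) i ≡ f i
    same i = trans (lookup≡ i) (cong f (cast-is-id refl i))

D-delete : ∀ {n} (Z : Subset n) x → lookup Z x ≡ true →
  Σ (Fin (size Z)) λ p → (enum Z p ≡ x) × (∀ M → D M (Z [ x ]≔ false) ≡ deleteDet M (enum Z) p)
D-delete Z x x∈Z with enum-delete Z x x∈Z
... | e , p , enum≡ with deleteDet-insertAt e (enum Z) (enum (Z [ x ]≔ false)) p x enum≡
... | p′ , enum≡x , det≡ = p′ , enum≡x , λ M → trans (D-enum M (Z [ x ]≔ false)) (det≡ M)

-- Case a ∉ Y: the pivot changes only row and column a, which M[Y] does not see.
pivotMat-outside : ∀ {n} (M : Mat n) a b x y → x ≢ a → y ≢ a → pivotMat M a b x y ≡ M x y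
pivotMat-outside M a b x y x≢a y≢a rewrite eqᵇ-false x≢a | eqᵇ-false y≢a =
  trans (xor-identityʳ _) (xor-identityʳ _)

D-pivot-outside : ∀ {n} (M : Mat n) a b Y → lookup Y a ≡ false → D (pivotMat M a b) Y ≡ D M Y
D-pivot-outside M a b Y a∉Y = begin
    D (pivotMat M a b) Y
  ≡⟨ D-enum (pivotMat M a b) Y ⟩
    det (size Y) (restrict (pivotMat M a b) (enum Y))
  ≡⟨ det-cong (size Y) (λ r c → pivotMat-outside M a b (enum Y r) (enum Y c) (notA r) (notA c)) ⟩
    det (size Y) (restrict M (enum Y))
  ≡⟨ sym (D-enum M Y) ⟩
    D M Y
  ∎
  where
  open ≡-Reasoning
  notA : ∀ i → enum Y i ≢ a
  notA i enum≡a with trans (sym (enum-∈ Y i)) (trans (cong (lookup Y) enum≡a) a∉Y)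
  ... | ()

-- Case a, b ∈ Y: M_ab[Y] = (M[Y])_ab, and pivoting preserves the determinant.
D-pivot-inside : ∀ {n} (M : Mat n) a b Y → a ≢ b → lookup Y a ≡ true → lookup Y b ≡ true →
  D (pivotMat M a b) Y ≡ D M Y
D-pivot-inside M a b Y a≢b a∈Y b∈Y with enum-surjective Y a a∈Y | enum-surjective Y b b∈Y
... | pa , enum≡a | pb , enum≡b = begin
    D (pivotMat M a b) Y
  ≡⟨ D-enum (pivotMat M a b) Y ⟩
    det (size Y) (restrict (pivotMat M a b) (enum Y))
  ≡⟨ det-cong (size Y) (pivotMat-restrict M (enum Y) (enum-injective Y) pa pb enum≡a enum≡b) ⟩
    det (size Y) (pivotMat (restrict M (enum Y)) pa pb)
  ≡⟨ det-pivotMat (size Y) (restrict M (enum Y)) pa pb pa≢pb ⟩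
    det (size Y) (restrict M (enum Y))
  ≡⟨ sym (D-enum M Y) ⟩
    D M Y
  ∎
  where
  open ≡-Reasoning
  pa≢pb : pa ≢ pb
  pa≢pb pa≡pb = a≢b (trans (sym enum≡a) (trans (cong (enum Y) pa≡pb) enum≡b))

-- For a, b ∈ Z: deleting b from Z after pivoting equals the sum of the two
-- deletions of b and of a, as both are minors of M[Z] (the identity of PivotMinor).
D-pivot-delete : ∀ {n} (M : Mat n) → Symmetric M → ∀ a b → a ≢ b → ∀ Z →
  lookup Z a ≡ true → lookup Z b ≡ true →
  D (pivotMat M a b) (Z [ b ]≔ false) ≡ D M (Z [ b ]≔ false) xor D M (Z [ a ]≔ false)
D-pivot-delete M M-sym a b a≢b Z a∈Z b∈Z with D-delete Z b b∈Z | D-delete Z a a∈Z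
... | q , enum≡b , D-withoutB | p , enum≡a , D-withoutA = begin
    D (pivotMat M a b) (Z [ b ]≔ false)
  ≡⟨ D-withoutB (pivotMat M a b) ⟩
    deleteDet (pivotMat M a b) (enum Z) q
  ≡⟨ cong₂ (λ x y → deleteDet (pivotMat M x y) (enum Z) q) (sym enum≡a) (sym enum≡b) ⟩
    deleteDet (pivotMat M (enum Z p) (enum Z q)) (enum Z) q
  ≡⟨ deleteDet-pivot M M-sym (enum Z) (enum-injective Z) p q p≢q ⟩
    deleteDet M (enum Z) q xor deleteDet M (enum Z) p
  ≡⟨ sym (cong₂ _xor_ (D-withoutB M) (D-withoutA M)) ⟩
    D M (Z [ b ]≔ false) xor D M (Z [ a ]≔ false)
  ∎
  where
  open ≡-Reasoning
  p≢q : p ≢ q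
  p≢q p≡q = a≢b (trans (sym enum≡a) (trans (cong (enum Z) p≡q) enum≡b))

-- Case a ∈ Y, b ∉ Y: apply D-pivot-delete to Z = Y ∪ {b}, for which
-- Z - b = Y and Z - a = (Y - a) ∪ {b}.
D-pivot-exchange : ∀ {n} (M : Mat n) → Symmetric M → ∀ a b → a ≢ b → ∀ Y →
  lookup Y a ≡ true → lookup Y b ≡ false →
  D (pivotMat M a b) Y ≡ D M Y xor D M ((Y [ a ]≔ false) [ b ]≔ true)
D-pivot-exchange M M-sym a b a≢b Y a∈Y b∉Y =
  subst₂ (λ X X′ → D (pivotMat M a b) X ≡ D M X xor D M X′) Z-b≡Y Z-a≡Y-a+b
    (D-pivot-delete M M-sym a b a≢b Z (trans (lookup∘update′ a≢b Y true) a∈Y) (lookup∘update b Y true))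
  where
  Z : Subset _
  Z = Y [ b ]≔ true
  Z-b≡Y : Z [ b ]≔ false ≡ Y
  Z-b≡Y = trans ([]≔-idempotent Y b) (trans (cong (Y [ b ]≔_) (sym b∉Y)) ([]≔-lookup Y b))
  Z-a≡Y-a+b : Z [ a ]≔ false ≡ (Y [ a ]≔ false) [ b ]≔ true
  Z-a≡Y-a+b = []≔-commutes Y b a (λ b≡a → a≢b (sym b≡a))

theorem3p3 : (n : ℕ) (M : Mat n) → Symmetric M → (a b : Fin n) → a ≢ b →
    (A : Subset n) → D (pivotMat M a b) A ≡ pivotSys (D M) a b A
-- By definition of D(M)_ab, the extra summand is present exactly when a ∈ A and b ∉ A.
theorem3p3 n M M-sym a b a≢b A with lookup A a in a∈A | lookup A b in b∈A
... | false | _     = trans (D-pivot-outside M a b A a∈A) (sym (xor-identityʳ _))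
... | true  | true  = trans (D-pivot-inside M a b A a≢b a∈A b∈A) (sym (xor-identityʳ _))
... | true  | false = D-pivot-exchange M M-sym a b a≢b A a∈A b∈A
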